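{- Let $q>2$ be an odd integer. Then $$\lim_{n\to\infty}\frac{f_{2,q}(n+1)}{f_{2,q}(n)}=1.$$
   Context: $\mathbb{N}$ denotes the set of nonnegative integers. For an odd integer $q>2$, $f_{2,q}(n)$ denotes the number of different expressions of the positive integer $n$ as a sum of distinct terms taken from $\{2^{\alpha}q^{\beta}:\alpha,\beta\in\mathbb{N}\}$ (i.e. the number of finite subsets of this set whose elements sum to $n$). -}

module Defs where

open import Data.Nat using (ℕ; zero; suc; _+_; _*_; _∸_; _^_; _≡ᵇ_; _≤ᵇ_)
open import Data.Bool using (Bool; true; false; if_then_else_)
open import Data.List using (List; []; _∷_; upTo; filterᵇ)
open import Data.Bool.ListAction using (any)

-- isTermᵇ q v = true  iff  v = 2^a * q^b for some a, b ∈ ℕ.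
-- (The search bound a, b ≤ v is harmless: 2^a * q^b = v with q ≥ 2 forces a, b < v.)
isTermᵇ : ℕ → ℕ → Bool
isTermᵇ q v = any (λ a → any (λ b → (2 ^ a * q ^ b) ≡ᵇ v) (upTo (suc v))) (upTo (suc v))

terms : ℕ → ℕ → List ℕ
terms q n = filterᵇ (isTermᵇ q) (upTo (suc n))

countSubsets : List ℕ → ℕ → ℕ
countSubsets []       m = if m ≡ᵇ 0 then 1 else 0
countSubsets (x ∷ xs) m =
  countSubsets xs m + (if x ≤ᵇ m then countSubsets xs (m ∸ x) else 0)

-- f q n = f_{2,q}(n): number of finite subsets of {2^a q^b} with sum n.
-- Only terms ≤ n can occur in such a subset, so it suffices to count subsets of (terms q n).
f : ℕ → ℕ → ℕ
f q n = countSubsets (terms q n) n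

{-# OPTIONS --safe #-}
module Submission where

-- Every n has exactly one representation by distinct powers of 2, and the terms 2^a q^b with
-- b ≥ 1 are q times the terms themselves. Peeling off the powers of 2 therefore gives
--   f(m + 1) = f(m) + [q ∣ m + 1] · f((m + 1) / q),
-- the coefficient form of (1 − X) ∏ (1 + X^(2^a q^b)) = ∏ (1 + X^(2^a q^(b+1))).
-- So f is nondecreasing, constant on each block qc, …, qc + q − 1, and
-- f(qc) = f(0) + ⋯ + f(c) ≥ (d + 1) f(c − d). The only nonzero differences are
-- f(q(c + 1)) − f(qc + q − 1) = f(c + 1), and the recurrence also gives
-- f(c + 1) ≤ f(c − d) + (d + 1) f(w) whenever c + 1 ≤ qw. Taking w = c − (d + 1)², both
-- (d + 1) f(c − d) and (d + 1)² f(w) are at most f(qc), so (d + 1) f(c + 1) ≤ 2 f(qc):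
-- the jumps are o(f).

open import Defs
import Algebra.Properties.CommutativeSemigroup as CommSemigroupProperties
open import Data.Bool using (T; true; false; if_then_else_)
open import Data.Bool.ListAction using (any)
open import Data.List using (List; []; _∷_; _++_; map; filter; upTo)
open import Data.List.Properties using (filter-accept; filter-reject)
open import Data.List.Membership.Propositional using (_∈_; find; lose)
open import Data.List.Membership.Propositional.Properties
  using (∈-filter⁺; ∈-filter⁻; ∈-upTo⁺; ∈-upTo⁻; ∈-map⁺; ∈-map⁻
        ; ∈-++⁺ˡ; ∈-++⁺ʳ; ∈-++⁻)
open import Data.List.Membership.Propositional.Properties.WithK using (unique∧set⇒bag)
open import Data.List.Relation.Binary.BagAndSetEquality using (∼bag⇒↭)
open import Data.List.Relation.Binary.Permutation.Propositional
  using (_↭_; refl; prep; swap; trans)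
open import Data.List.Relation.Unary.All as All using (All; []; _∷_)
open import Data.List.Relation.Unary.Any using (here; there)
open import Data.List.Relation.Unary.Any.Properties using (any⁺; any⁻)
open import Data.List.Relation.Unary.Unique.Propositional using (Unique; []; _∷_)
import Data.List.Relation.Unary.Unique.Propositional.Properties as Unique
open import Data.Nat
  using ( ℕ; zero; suc; pred; _+_; _*_; _∸_; _^_; ∣_-_∣; _≤ᵇ_; _≡ᵇ_
        ; _≤_; _<_; _≥_; _>_; z≤n; s≤s; s≤s⁻¹; z<s; _≤′_; ≤′-refl; ≤′-step
        ; NonZero; >-nonZero )
open import Data.Nat.Coprimality using (Coprime; coprime-divisor)
open import Data.Nat.Divisibility
  using ( _∣_; _∣?_; divides; quotient
        ; _∣0; 0∣⇒≡0; ∣⇒≤; m∣m*n; ∣m∣n⇒∣m+n; ∣m+n∣m⇒∣n )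
open import Data.Nat.Properties
open import Data.Product using (∃; ∃₂; _×_; _,_)
open import Data.Sum using (inj₁; inj₂)
open import Function using (_∘_; _⇔_; mk⇔; Equivalence)
open import Relation.Nullary using (¬_; yes; no; contradiction)
open import Relation.Nullary.Decidable using (T?)
open import Relation.Binary.PropositionalEquality
  using (_≡_; refl; sym; cong; cong₂; subst; module ≡-Reasoning)
  renaming (trans to ≡-trans)

module + = CommSemigroupProperties +-commutativeSemigroup
module * = CommSemigroupProperties *-commutativeSemigroup

-- Counting subsets

-- countSubsets (x ∷ xs) m = countSubsets xs m + shift x (countSubsets xs) m holds by definition;
-- on generating functions, shift x is multiplication by X^x.
shift : ℕ → (ℕ → ℕ) → ℕ → ℕ
shift x h m = if x ≤ᵇ m then h (m ∸ x) else 0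

data Offset (x m : ℕ) : Set where
  below : m < x → Offset x m
  above : ∀ d → m ≡ x + d → Offset x m

offset : ∀ x m → Offset x m
offset x m with x ≤? m
... | yes x≤m = above (m ∸ x) (sym (m+[n∸m]≡n x≤m))
... | no x≰m  = below (≰⇒> x≰m)

shift-below : ∀ {x m} h → m < x → shift x h m ≡ 0
shift-below {x} {m} h m<x with x ≤ᵇ m in eq
... | true  = contradiction (≤ᵇ⇒≤ x m (subst T (sym eq) _)) (<⇒≱ m<x)
... | false = refl

shift-above : ∀ x h d → shift x h (x + d) ≡ h d
shift-above x h d with x ≤ᵇ x + d in eq
... | true  = cong h (m+n∸m≡n x d)
... | false = contradiction (subst T eq (≤⇒≤ᵇ (m≤m+n x d))) λ ()

shift-cong : ∀ x {h h′ m} → (∀ {i} → i ≤ m → h i ≡ h′ i) → shift x h m ≡ shift x h′ m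
shift-cong x {m = m} h≗h′ with x ≤ᵇ m
... | true  = h≗h′ (m∸n≤m m x)
... | false = refl

shift-+ : ∀ x h h′ m → shift x (λ i → h i + h′ i) m ≡ shift x h m + shift x h′ m
shift-+ x h h′ m with x ≤ᵇ m
... | true  = refl
... | false = refl

shift-shift : ∀ x y h m → shift x (shift y h) m ≡ shift (x + y) h m
shift-shift x y h m with offset x m
... | below m<x =
  ≡-trans (shift-below (shift y h) m<x) (sym (shift-below h (<-≤-trans m<x (m≤m+n x y))))
... | above d refl with offset y d
...   | below d<y = ≡-trans (shift-above x (shift y h) d)
        (≡-trans (shift-below h d<y) (sym (shift-below h (+-monoʳ-< x d<y))))
...   | above e refl = begin
  shift x (shift y h) (x + (y + e))  ≡⟨ shift-above x (shift y h) (y + e) ⟩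
  shift y h (y + e)                  ≡⟨ shift-above y h e ⟩
  h e                                ≡⟨ shift-above (x + y) h e ⟨
  shift (x + y) h (x + y + e)        ≡⟨ cong (shift (x + y) h) (+-assoc x y e) ⟩
  shift (x + y) h (x + (y + e))      ∎
  where open ≡-Reasoning

shift-comm : ∀ x y h m → shift x (shift y h) m ≡ shift y (shift x h) m
shift-comm x y h m = begin
  shift x (shift y h) m  ≡⟨ shift-shift x y h m ⟩
  shift (x + y) h m      ≡⟨ cong (λ z → shift z h m) (+-comm x y) ⟩
  shift (y + x) h m      ≡⟨ shift-shift y x h m ⟨
  shift y (shift x h) m  ∎
  where open ≡-Reasoning

countSubsets-∷-cong : ∀ x xs ys → (∀ m → countSubsets xs m ≡ countSubsets ys m) →
                      ∀ m → countSubsets (x ∷ xs) m ≡ countSubsets (x ∷ ys) m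
countSubsets-∷-cong x xs ys xs≗ys m =
  cong₂ _+_ (xs≗ys m) (shift-cong x {countSubsets xs} {countSubsets ys} λ _ → xs≗ys _)

countSubsets-swap : ∀ x y xs m → countSubsets (x ∷ y ∷ xs) m ≡ countSubsets (y ∷ x ∷ xs) m
countSubsets-swap x y xs m = begin
  (C m + shift y C m) + shift x (λ i → C i + shift y C i) m
    ≡⟨ cong (C m + shift y C m +_) (shift-+ x C (shift y C) m) ⟩
  (C m + shift y C m) + (shift x C m + shift x (shift y C) m)
    ≡⟨ +.interchange (C m) (shift y C m) (shift x C m) (shift x (shift y C) m) ⟩
  (C m + shift x C m) + (shift y C m + shift x (shift y C) m)
    ≡⟨ cong (λ z → C m + shift x C m + (shift y C m + z)) (shift-comm x y C m) ⟩
  (C m + shift x C m) + (shift y C m + shift y (shift x C) m)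
    ≡⟨ cong (C m + shift x C m +_) (shift-+ y C (shift x C) m) ⟨
  (C m + shift x C m) + shift y (λ i → C i + shift x C i) m
    ∎
  where
  open ≡-Reasoning
  C = countSubsets xs

countSubsets-↭ : ∀ {xs ys} → xs ↭ ys → ∀ m → countSubsets xs m ≡ countSubsets ys m
countSubsets-↭ refl m = refl
countSubsets-↭ (prep {xs} {ys} x p) = countSubsets-∷-cong x xs ys (countSubsets-↭ p)
countSubsets-↭ (swap {xs} {ys} x y p) m = ≡-trans (countSubsets-swap x y xs m)
  (countSubsets-∷-cong y (x ∷ xs) (x ∷ ys) (countSubsets-∷-cong x xs ys (countSubsets-↭ p)) m)
countSubsets-↭ (trans p p′) m = ≡-trans (countSubsets-↭ p m) (countSubsets-↭ p′ m)

countSubsets-filter-≤ : ∀ {m n} xs → m ≤ n →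
                        countSubsets (filter (_≤? n) xs) m ≡ countSubsets xs m
countSubsets-filter-≤ [] m≤n = refl
countSubsets-filter-≤ {m} {n} (x ∷ xs) m≤n with x ≤? n
... | yes x≤n = ≡-trans (cong (λ l → countSubsets l m) (filter-accept (_≤? n) x≤n))
  (cong₂ _+_ (countSubsets-filter-≤ xs m≤n)
             (shift-cong x λ i≤m → countSubsets-filter-≤ xs (≤-trans i≤m m≤n)))
... | no x≰n = begin
  countSubsets (filter (_≤? n) (x ∷ xs)) m
    ≡⟨ cong (λ l → countSubsets l m) (filter-reject (_≤? n) x≰n) ⟩
  countSubsets (filter (_≤? n) xs) m
    ≡⟨ countSubsets-filter-≤ xs m≤n ⟩
  countSubsets xs m
    ≡⟨ +-identityʳ _ ⟨
  countSubsets xs m + 0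
    ≡⟨ cong (countSubsets xs m +_) (shift-below (countSubsets xs) (≤-<-trans m≤n (≰⇒> x≰n))) ⟨
  countSubsets (x ∷ xs) m
    ∎
  where open ≡-Reasoning

countSubsets-≤-agree : ∀ {m xs ys} → Unique xs → Unique ys →
                       (∀ {z} → z ≤ m → z ∈ xs ⇔ z ∈ ys) →
                       countSubsets xs m ≡ countSubsets ys m
countSubsets-≤-agree {m} {xs} {ys} xs! ys! agree = begin
  countSubsets xs m                   ≡⟨ countSubsets-filter-≤ xs ≤-refl ⟨
  countSubsets (filter (_≤? m) xs) m  ≡⟨ countSubsets-↭ xs≤m↭ys≤m m ⟩
  countSubsets (filter (_≤? m) ys) m  ≡⟨ countSubsets-filter-≤ ys ≤-refl ⟩
  countSubsets ys m                   ∎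
  where
  open ≡-Reasoning
  restrict : ∀ {as bs} → (∀ {z} → z ∈ xs ⇔ z ∈ ys → z ∈ as → z ∈ bs) →
             ∀ {z} → z ∈ filter (_≤? m) as → z ∈ filter (_≤? m) bs
  restrict move z∈ with ∈-filter⁻ (_≤? m) z∈
  ... | z∈as , z≤m = ∈-filter⁺ (_≤? m) (move (agree z≤m) z∈as) z≤m
  xs≤m↭ys≤m : filter (_≤? m) xs ↭ filter (_≤? m) ys
  xs≤m↭ys≤m = ∼bag⇒↭ (unique∧set⇒bag
    (Unique.filter⁺ (_≤? m) xs!) (Unique.filter⁺ (_≤? m) ys!)
    (mk⇔ (restrict Equivalence.to) (restrict Equivalence.from)))

shift-* : ∀ d {{_ : NonZero d}} x {h h′} → (∀ i → h (d * i) ≡ h′ i) →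
          ∀ j → shift (d * x) h (d * j) ≡ shift x h′ j
shift-* d x {h} {h′} h∘d≗h′ j with offset x j
... | below j<x = ≡-trans (shift-below h (*-monoʳ-< d j<x)) (sym (shift-below h′ j<x))
... | above i refl = begin
  shift (d * x) h (d * (x + i))    ≡⟨ cong (shift (d * x) h) (*-distribˡ-+ d x i) ⟩
  shift (d * x) h (d * x + d * i)  ≡⟨ shift-above (d * x) h (d * i) ⟩
  h (d * i)                        ≡⟨ h∘d≗h′ i ⟩
  h′ i                             ≡⟨ shift-above x h′ i ⟨
  shift x h′ (x + i)               ∎
  where open ≡-Reasoning

countSubsets-map-* : ∀ d {{_ : NonZero d}} xs j →
                     countSubsets (map (d *_) xs) (d * j) ≡ countSubsets xs j
countSubsets-map-* d [] zero = cong (λ z → if z ≡ᵇ 0 then 1 else 0) (*-zeroʳ d)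
countSubsets-map-* (suc d) [] (suc j) = refl
countSubsets-map-* d (x ∷ xs) j = cong₂ _+_ (countSubsets-map-* d xs j)
  (shift-* d x {countSubsets (map (d *_) xs)} (countSubsets-map-* d xs) j)

countSubsets-map-*-∤ : ∀ d xs {m} → ¬ d ∣ m → countSubsets (map (d *_) xs) m ≡ 0
countSubsets-map-*-∤ d [] {zero} d∤0 = contradiction (d ∣0) d∤0
countSubsets-map-*-∤ d [] {suc m} d∤m = refl
countSubsets-map-*-∤ d (x ∷ xs) {m} d∤m with offset (d * x) m
... | below m<dx = cong₂ _+_ (countSubsets-map-*-∤ d xs d∤m)
                             (shift-below (countSubsets (map (d *_) xs)) m<dx)
... | above e refl = cong₂ _+_ (countSubsets-map-*-∤ d xs d∤m)
  (≡-trans (shift-above (d * x) (countSubsets (map (d *_) xs)) e)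
           (countSubsets-map-*-∤ d xs λ d∣e → d∤m (∣m∣n⇒∣m+n (m∣m*n x) d∣e)))

doublings : ℕ → ℕ → List ℕ
doublings c zero    = []
doublings c (suc K) = c ∷ doublings (2 * c) K

m^n*[m*o]≡m^[1+n]*o : ∀ m n o → m ^ n * (m * o) ≡ m ^ suc n * o
m^n*[m*o]≡m^[1+n]*o m n o = ≡-trans (*.x∙yz≈y∙xz (m ^ n) m o) (sym (*-assoc m (m ^ n) o))

-- The coefficient form of (1 − X^c) ∏_{a<K} (1 + X^(2^a c)) = 1 − X^(2^K c); the bound on m
-- keeps the last term out of sight.
countSubsets-doublings-++ : ∀ K c rest {m} → m < 2 ^ K * c →
  countSubsets (doublings c K ++ rest) m ≡
  countSubsets rest m + shift c (countSubsets (doublings c K ++ rest)) m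
countSubsets-doublings-++ zero c rest {m} m<1*c = sym (≡-trans
  (cong (countSubsets rest m +_) (shift-below (countSubsets rest) (subst (m <_) (*-identityˡ c) m<1*c)))
  (+-identityʳ _))
countSubsets-doublings-++ (suc K) c rest {m} m<2^[1+K]*c = begin
  D m + shift c D m
    ≡⟨ cong (_+ shift c D m) (countSubsets-doublings-++ K (2 * c) rest m<2^K*[2*c]) ⟩
  R m + shift (2 * c) D m + shift c D m
    ≡⟨ +.xy∙z≈x∙zy (R m) (shift (2 * c) D m) (shift c D m) ⟩
  R m + (shift c D m + shift (2 * c) D m)
    ≡⟨ cong (λ z → R m + (shift c D m + shift (c + z) D m)) (+-identityʳ c) ⟩
  R m + (shift c D m + shift (c + c) D m)
    ≡⟨ cong (λ z → R m + (shift c D m + z)) (shift-shift c c D m) ⟨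
  R m + (shift c D m + shift c (shift c D) m)
    ≡⟨ cong (R m +_) (shift-+ c D (shift c D) m) ⟨
  R m + shift c (λ i → D i + shift c D i) m
    ∎
  where
  open ≡-Reasoning
  D = countSubsets (doublings (2 * c) K ++ rest)
  R = countSubsets rest
  m<2^K*[2*c] : m < 2 ^ K * (2 * c)
  m<2^K*[2*c] = subst (m <_) (sym (m^n*[m*o]≡m^[1+n]*o 2 K c)) m<2^[1+K]*c

doublings-≥ : ∀ c K → All (c ≤_) (doublings c K)
doublings-≥ c zero    = []
doublings-≥ c (suc K) = ≤-refl ∷ All.map (≤-trans (m≤n*m c 2)) (doublings-≥ (2 * c) K)

doublings-unique : ∀ c .{{_ : NonZero c}} K → Unique (doublings c K)
doublings-unique c zero    = []
doublings-unique c (suc K) =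
  All.map (λ 2c≤z → <⇒≢ (<-≤-trans c<2c 2c≤z)) (doublings-≥ (2 * c) K)
  ∷ doublings-unique (2 * c) {{m*n≢0 2 c}} K
  where
  c<2c : c < 2 * c
  c<2c = subst (c <_) (*-comm c 2) (m<m*n c 2 ≤-refl)

doublings-∈⁻ : ∀ c K {z} → z ∈ doublings c K → ∃ λ a → 2 ^ a * c ≡ z
doublings-∈⁻ c (suc K) (here refl) = 0 , *-identityˡ c
doublings-∈⁻ c (suc K) (there z∈) with doublings-∈⁻ (2 * c) K z∈
... | a , refl = suc a , sym (m^n*[m*o]≡m^[1+n]*o 2 a c)

doublings-∈⁺ : ∀ c {K a} → a < K → 2 ^ a * c ∈ doublings c K
doublings-∈⁺ c {suc K} {zero}  _          = here (*-identityˡ c)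
doublings-∈⁺ c {suc K} {suc a} (s≤s a<K) = there
  (subst (_∈ doublings (2 * c) K) (m^n*[m*o]≡m^[1+n]*o 2 a c) (doublings-∈⁺ (2 * c) a<K))

-- The terms 2^a q^b

IsTerm : ℕ → ℕ → Set
IsTerm q v = ∃₂ λ a b → 2 ^ a * q ^ b ≡ v

grid : ℕ → ℕ → ℕ → List ℕ
grid q K zero    = []
grid q K (suc B) = doublings 1 K ++ map (q *_) (grid q K B)

grid-∈⁻ : ∀ q K B {z} → z ∈ grid q K B → IsTerm q z
grid-∈⁻ q K (suc B) z∈ with ∈-++⁻ (doublings 1 K) z∈
... | inj₁ z∈doublings with doublings-∈⁻ 1 K z∈doublings
...   | a , 2^a*1≡z = a , 0 , 2^a*1≡z
grid-∈⁻ q K (suc B) z∈ | inj₂ z∈q*grid with ∈-map⁻ (q *_) z∈q*grid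
...   | y , y∈grid , refl with grid-∈⁻ q K B y∈grid
...     | a , b , refl = a , suc b , *.x∙yz≈y∙xz (2 ^ a) q (q ^ b)

grid-∈⁺ : ∀ q {K B a b} → a < K → b < B → 2 ^ a * q ^ b ∈ grid q K B
grid-∈⁺ q {K} {suc B} {b = zero} a<K _ = ∈-++⁺ˡ (doublings-∈⁺ 1 a<K)
grid-∈⁺ q {K} {suc B} {a} {suc b} a<K (s≤s b<B) = ∈-++⁺ʳ (doublings 1 K)
  (subst (_∈ map (q *_) (grid q K B)) (sym (*.x∙yz≈y∙xz (2 ^ a) q (q ^ b)))
         (∈-map⁺ (q *_) (grid-∈⁺ q a<K b<B)))

odd⇒coprime-2 : ∀ {q} → ¬ 2 ∣ q → Coprime q 2
odd⇒coprime-2 _     {zero} (_ , 0∣2) = contradiction (0∣⇒≡0 0∣2) λ ()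
odd⇒coprime-2 _     {1}    _         = refl
odd⇒coprime-2 q-odd {2}    (2∣q , _) = contradiction 2∣q q-odd
odd⇒coprime-2 _ {suc (suc (suc d))} (_ , 3+d∣2) with ∣⇒≤ 3+d∣2
... | s≤s (s≤s ())

odd∤2^ : ∀ {q} → 1 < q → ¬ 2 ∣ q → ∀ a → ¬ q ∣ 2 ^ a
odd∤2^ 1<q _     zero    q∣1         = <⇒≱ 1<q (∣⇒≤ q∣1)
odd∤2^ 1<q q-odd (suc a) q∣2^[1+a] =
  odd∤2^ 1<q q-odd a (coprime-divisor (odd⇒coprime-2 q-odd) q∣2^[1+a])

grid-unique : ∀ {q} → 1 < q → ¬ 2 ∣ q → ∀ K B → Unique (grid q K B)
grid-unique 1<q q-odd K zero = []
grid-unique {q} 1<q q-odd K (suc B) = Unique.++⁺ (doublings-unique 1 K)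
  (Unique.map⁺ (*-cancelˡ-≡ _ _ q {{q≢0}}) (grid-unique 1<q q-odd K B)) disjoint
  where
  q≢0 : NonZero q
  q≢0 = >-nonZero (<-trans z<s 1<q)
  disjoint : ∀ {v} → ¬ (v ∈ doublings 1 K × v ∈ map (q *_) (grid q K B))
  disjoint {v} (v∈doublings , v∈q*grid)
    with doublings-∈⁻ 1 K v∈doublings | ∈-map⁻ (q *_) v∈q*grid
  ... | a , 2^a*1≡v | y , _ , v≡q*y = odd∤2^ 1<q q-odd a (divides y (begin
    2 ^ a      ≡⟨ *-identityʳ (2 ^ a) ⟨
    2 ^ a * 1  ≡⟨ 2^a*1≡v ⟩
    v          ≡⟨ v≡q*y ⟩
    q * y      ≡⟨ *-comm q y ⟩
    y * q      ∎))
    where open ≡-Reasoning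

n<m^n : ∀ {m} → 1 < m → ∀ n → n < m ^ n
n<m^n 1<m zero = z<s
n<m^n {m@(suc _)} 1<m (suc n) = ≤-<-trans (n<m^n 1<m n)
  (subst (m ^ n <_) (*-comm (m ^ n) m) (m<m*n (m ^ n) m {{m^n≢0 m n}} 1<m))

exponents-≤ : ∀ {q a b v} → 1 < q → 2 ^ a * q ^ b ≡ v → a ≤ v × b ≤ v
exponents-≤ {q@(suc _)} {a} {b} 1<q refl =
  ≤-trans (<⇒≤ (n<m^n ≤-refl a)) (m≤m*n (2 ^ a) (q ^ b) {{m^n≢0 q b}}) ,
  ≤-trans (<⇒≤ (n<m^n 1<q b)) (m≤n*m (q ^ b) (2 ^ a) {{m^n≢0 2 a}})

isTermᵇ-sound : ∀ q v → T (isTermᵇ q v) → IsTerm q v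
isTermᵇ-sound q v t with find (any⁻ _ (upTo (suc v)) t)
... | a , _ , t′ with find (any⁻ _ (upTo (suc v)) t′)
...   | b , _ , t″ = a , b , ≡ᵇ⇒≡ _ _ t″

isTermᵇ-complete : ∀ {q v} → 1 < q → IsTerm q v → T (isTermᵇ q v)
isTermᵇ-complete {q} {v} 1<q (a , b , e) with exponents-≤ {q} {a} {b} 1<q e
... | a≤v , b≤v =
  any⁺ (λ a′ → any (λ b′ → 2 ^ a′ * q ^ b′ ≡ᵇ v) (upTo (suc v)))
       (lose (∈-upTo⁺ (s≤s a≤v))
             (any⁺ (λ b′ → 2 ^ a * q ^ b′ ≡ᵇ v)
                   (lose (∈-upTo⁺ (s≤s b≤v)) (≡⇒≡ᵇ (2 ^ a * q ^ b) v e))))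

terms-unique : ∀ q m → Unique (terms q m)
terms-unique q m = Unique.filter⁺ (T? ∘ isTermᵇ q) {upTo (suc m)} (Unique.upTo⁺ (suc m))

terms-∈⁻ : ∀ q m {z} → z ∈ terms q m → z ≤ m × IsTerm q z
terms-∈⁻ q m z∈ with ∈-filter⁻ (T? ∘ isTermᵇ q) {xs = upTo (suc m)} z∈
... | z∈upTo , t = s≤s⁻¹ (∈-upTo⁻ z∈upTo) , isTermᵇ-sound q _ t

terms-∈⁺ : ∀ {q m z} → 1 < q → z ≤ m → IsTerm q z → z ∈ terms q m
terms-∈⁺ {q} {m} 1<q z≤m z-term = ∈-filter⁺ (T? ∘ isTermᵇ q) {xs = upTo (suc m)}
  (∈-upTo⁺ (s≤s z≤m)) (isTermᵇ-complete 1<q z-term)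

f≡countSubsets-grid : ∀ {q K B m} → 1 < q → ¬ 2 ∣ q → m < K → m < B →
                      f q m ≡ countSubsets (grid q K B) m
f≡countSubsets-grid {q} {K} {B} {m} 1<q q-odd m<K m<B =
  countSubsets-≤-agree (terms-unique q m) (grid-unique 1<q q-odd K B) λ z≤m → mk⇔ to (from z≤m)
  where
  to : ∀ {z} → z ∈ terms q m → z ∈ grid q K B
  to z∈ with terms-∈⁻ q m z∈
  ... | z≤m , a , b , refl with exponents-≤ {q} {a} {b} 1<q refl
  ...   | a≤z , b≤z =
    grid-∈⁺ q (≤-<-trans (≤-trans a≤z z≤m) m<K) (≤-<-trans (≤-trans b≤z z≤m) m<B)
  from : ∀ {z} → z ≤ m → z ∈ grid q K B → z ∈ terms q m
  from z≤m z∈ = terms-∈⁺ 1<q z≤m (grid-∈⁻ q K B z∈)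

-- The recurrence for f

module _ {q} (1<q : 1 < q) (q-odd : ¬ 2 ∣ q) where

  private
    q*grid : ℕ → List ℕ
    q*grid m = map (q *_) (grid q (2 + m) (2 + m))

  f-suc : ∀ m → f q (suc m) ≡ countSubsets (q*grid m) (suc m) + f q m
  f-suc m = begin
    f q (suc m)
      ≡⟨ f≡countSubsets-grid 1<q q-odd (m<n+m (suc m) {1} z<s) (m<n+m (suc m) {2} z<s) ⟩
    countSubsets (doublings 1 K ++ q*grid m) (suc m)
      ≡⟨ countSubsets-doublings-++ K 1 (q*grid m) 1+m<2^K*1 ⟩
    countSubsets (q*grid m) (suc m) + shift 1 (countSubsets (grid q K (suc K))) (suc m)
      ≡⟨ cong (countSubsets (q*grid m) (suc m) +_) (shift-above 1 (countSubsets (grid q K (suc K))) m) ⟩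
    countSubsets (q*grid m) (suc m) + countSubsets (grid q K (suc K)) m
      ≡⟨ cong (countSubsets (q*grid m) (suc m) +_)
              (f≡countSubsets-grid {m = m} 1<q q-odd (m<n+m m {2} z<s) (m<n+m m {3} z<s)) ⟨
    countSubsets (q*grid m) (suc m) + f q m
      ∎
    where
    open ≡-Reasoning
    K = 2 + m
    1+m<2^K*1 : suc m < 2 ^ K * 1
    1+m<2^K*1 = subst (suc m <_) (sym (*-identityʳ (2 ^ K))) (<-trans (n<1+n (suc m)) (n<m^n ≤-refl K))

  f-suc-∤ : ∀ {m} → ¬ q ∣ suc m → f q (suc m) ≡ f q m
  f-suc-∤ {m} q∤1+m =
    ≡-trans (f-suc m) (cong (_+ f q m) (countSubsets-map-*-∤ q (grid q (2 + m) (2 + m)) q∤1+m))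

  f-suc-∣ : ∀ {m} (q∣1+m : q ∣ suc m) → f q (suc m) ≡ f q m + f q (quotient q∣1+m)
  f-suc-∣ {m} (divides j 1+m≡j*q) = begin
    f q (suc m)
      ≡⟨ f-suc m ⟩
    countSubsets (q*grid m) (suc m) + f q m
      ≡⟨ cong (λ z → countSubsets (q*grid m) z + f q m) 1+m≡q*j ⟩
    countSubsets (q*grid m) (q * j) + f q m
      ≡⟨ cong (_+ f q m) (countSubsets-map-* q {{q≢0}} (grid q K K) j) ⟩
    countSubsets (grid q K K) j + f q m
      ≡⟨ cong (_+ f q m) (f≡countSubsets-grid 1<q q-odd j<K j<K) ⟨
    f q j + f q m
      ≡⟨ +-comm (f q j) (f q m) ⟩
    f q m + f q j
      ∎
    where
    open ≡-Reasoning
    K = 2 + m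
    q≢0 : NonZero q
    q≢0 = >-nonZero (<-trans z<s 1<q)
    1+m≡q*j : suc m ≡ q * j
    1+m≡q*j = ≡-trans 1+m≡j*q (*-comm j q)
    j<K : j < K
    j<K = s≤s (subst (j ≤_) (sym 1+m≡j*q) (m≤m*n j q {{q≢0}}))

-- Solutions of the recurrence grow slowly

-- For c ≥ threshold d, w = c ∸ (d + 1)² satisfies c + 1 ≤ 2w.
threshold : ℕ → ℕ
threshold d = suc (suc d * suc d + suc d * suc d)

module _ {q} (1<q : 1 < q) (F : ℕ → ℕ) (F[0]>0 : F 0 > 0)
         (F-suc-∤ : ∀ {m} → ¬ q ∣ suc m → F (suc m) ≡ F m)
         (F-suc-∣ : ∀ {m} (q∣1+m : q ∣ suc m) → F (suc m) ≡ F m + F (quotient q∣1+m)) where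

  private instance
    q≢0 : NonZero q
    q≢0 = >-nonZero (<-trans z<s 1<q)

  F-mono-suc : ∀ m → F m ≤ F (suc m)
  F-mono-suc m with q ∣? suc m
  ... | yes q∣1+m = ≤-trans (m≤m+n (F m) (F (quotient q∣1+m))) (≤-reflexive (sym (F-suc-∣ q∣1+m)))
  ... | no q∤1+m  = ≤-reflexive (sym (F-suc-∤ q∤1+m))

  F-mono : ∀ {m n} → m ≤ n → F m ≤ F n
  F-mono = mono′ ∘ ≤⇒≤′
    where
    mono′ : ∀ {m n} → m ≤′ n → F m ≤ F n
    mono′ ≤′-refl        = ≤-refl
    mono′ (≤′-step m≤′n) = ≤-trans (mono′ m≤′n) (F-mono-suc _)

  F>0 : ∀ m → F m > 0
  F>0 m = <-≤-trans F[0]>0 (F-mono z≤n)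

  F[1+m]≤F[m]+F[w] : ∀ {m w} → suc m ≤ q * w → F (suc m) ≤ F m + F w
  F[1+m]≤F[m]+F[w] {m} {w} 1+m≤q*w with q ∣? suc m
  ... | yes q∣1+m@(divides j 1+m≡j*q) =
    ≤-trans (≤-reflexive (F-suc-∣ q∣1+m)) (+-monoʳ-≤ (F m) (F-mono j≤w))
    where
    j≤w : j ≤ w
    j≤w = *-cancelˡ-≤ q (subst (_≤ q * w) (≡-trans 1+m≡j*q (*-comm j q)) 1+m≤q*w)
  ... | no q∤1+m = ≤-trans (≤-reflexive (F-suc-∤ q∤1+m)) (m≤m+n (F m) (F w))

  F[s+t]≤F[s]+t*F[w] : ∀ s t {w} → s + t ≤ q * w → F (s + t) ≤ F s + t * F w
  F[s+t]≤F[s]+t*F[w] s zero _ =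
    ≤-reflexive (≡-trans (cong F (+-identityʳ s)) (sym (+-identityʳ (F s))))
  F[s+t]≤F[s]+t*F[w] s (suc t) {w} s+[1+t]≤q*w = begin
    F (s + suc t)        ≡⟨ cong F (+-suc s t) ⟩
    F (suc (s + t))      ≤⟨ F[1+m]≤F[m]+F[w] (subst (_≤ q * w) (+-suc s t) s+[1+t]≤q*w) ⟩
    F (s + t) + F w      ≤⟨ +-monoˡ-≤ (F w) (F[s+t]≤F[s]+t*F[w] s t s+t≤q*w) ⟩
    F s + t * F w + F w  ≡⟨ +.xy∙z≈x∙zy (F s) (t * F w) (F w) ⟩
    F s + suc t * F w    ∎
    where
    open ≤-Reasoning
    s+t≤q*w : s + t ≤ q * w
    s+t≤q*w = ≤-trans (≤-trans (n≤1+n (s + t)) (≤-reflexive (sym (+-suc s t)))) s+[1+t]≤q*w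

  F-block : ∀ c {r} → r < q → F (q * c + r) ≡ F (q * c)
  F-block c {zero}  _     = cong F (+-identityʳ (q * c))
  F-block c {suc r} 1+r<q = begin
    F (q * c + suc r)    ≡⟨ cong F (+-suc (q * c) r) ⟩
    F (suc (q * c + r))  ≡⟨ F-suc-∤ q∤ ⟩
    F (q * c + r)        ≡⟨ F-block c (<-trans (n<1+n r) 1+r<q) ⟩
    F (q * c)            ∎
    where
    open ≡-Reasoning
    q∤ : ¬ q ∣ suc (q * c + r)
    q∤ q∣ = <⇒≱ 1+r<q
      (∣⇒≤ (∣m+n∣m⇒∣n (subst (q ∣_) (sym (+-suc (q * c) r)) q∣) (m∣m*n c)))

  1+[q*c+pred[q]]≡[1+c]*q : ∀ c → suc (q * c + pred q) ≡ suc c * q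
  1+[q*c+pred[q]]≡[1+c]*q c = begin
    suc (q * c + pred q)  ≡⟨ +-suc (q * c) (pred q) ⟨
    q * c + suc (pred q)  ≡⟨ cong (q * c +_) (suc-pred q) ⟩
    q * c + q             ≡⟨ +-comm (q * c) q ⟩
    q + q * c             ≡⟨ *-suc q c ⟨
    q * suc c             ≡⟨ *-comm q (suc c) ⟩
    suc c * q             ∎
    where open ≡-Reasoning

  F[q*[1+c]]≡F[q*c]+F[1+c] : ∀ c → F (q * suc c) ≡ F (q * c) + F (suc c)
  F[q*[1+c]]≡F[q*c]+F[1+c] c = begin
    F (q * suc c)
      ≡⟨ cong F (≡-trans (*-comm q (suc c)) (sym (1+[q*c+pred[q]]≡[1+c]*q c))) ⟩
    F (suc (q * c + pred q))
      ≡⟨ F-suc-∣ (divides (suc c) (1+[q*c+pred[q]]≡[1+c]*q c)) ⟩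
    F (q * c + pred q) + F (suc c)
      ≡⟨ cong (_+ F (suc c)) (F-block c (≤-reflexive (suc-pred q))) ⟩
    F (q * c) + F (suc c)
      ∎
    where open ≡-Reasoning

  [1+d]*F[s]≤F[q*[s+d]] : ∀ s d → suc d * F s ≤ F (q * (s + d))
  [1+d]*F[s]≤F[q*[s+d]] s zero = begin
    F s + 0          ≡⟨ +-identityʳ (F s) ⟩
    F s              ≤⟨ F-mono (≤-trans (m≤m+n s 0) (m≤n*m (s + 0) q)) ⟩
    F (q * (s + 0))  ∎
    where open ≤-Reasoning
  [1+d]*F[s]≤F[q*[s+d]] s (suc d) = begin
    F s + suc d * F s
      ≤⟨ +-mono-≤ (F-mono (≤-trans (m≤m+n s d) (n≤1+n (s + d)))) ([1+d]*F[s]≤F[q*[s+d]] s d) ⟩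
    F (suc (s + d)) + F (q * (s + d))
      ≡⟨ +-comm (F (suc (s + d))) (F (q * (s + d))) ⟩
    F (q * (s + d)) + F (suc (s + d))
      ≡⟨ F[q*[1+c]]≡F[q*c]+F[1+c] (s + d) ⟨
    F (q * suc (s + d))
      ≡⟨ cong (λ z → F (q * z)) (+-suc s d) ⟨
    F (q * (s + suc d))
      ∎
    where open ≤-Reasoning

  F[1+c]-estimate : ∀ {d c s w} → s + d ≡ c → w + suc d * suc d ≡ c → suc c ≤ q * w →
                    suc d * F (suc c) ≤ 2 * F (q * c)
  F[1+c]-estimate {d} {c} {s} {w} s+d≡c w+[1+d]²≡c 1+c≤q*w = begin
    suc d * F (suc c)
      ≡⟨ cong (λ z → suc d * F z) s+[1+d]≡1+c ⟨
    suc d * F (s + suc d)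
      ≤⟨ *-monoʳ-≤ (suc d)
           (F[s+t]≤F[s]+t*F[w] s (suc d) (subst (_≤ q * w) (sym s+[1+d]≡1+c) 1+c≤q*w)) ⟩
    suc d * (F s + suc d * F w)
      ≡⟨ *-distribˡ-+ (suc d) (F s) (suc d * F w) ⟩
    suc d * F s + suc d * (suc d * F w)
      ≡⟨ cong (suc d * F s +_) (*-assoc (suc d) (suc d) (F w)) ⟨
    suc d * F s + [1+d]² * F w
      ≤⟨ +-mono-≤ (subst (λ z → suc d * F s ≤ F (q * z)) s+d≡c ([1+d]*F[s]≤F[q*[s+d]] s d))
                  (≤-trans (m≤n+m ([1+d]² * F w) (F w))
                           (subst (λ z → suc [1+d]² * F w ≤ F (q * z)) w+[1+d]²≡c
                                  ([1+d]*F[s]≤F[q*[s+d]] w [1+d]²))) ⟩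
    F (q * c) + F (q * c)
      ≡⟨ cong (F (q * c) +_) (+-identityʳ (F (q * c))) ⟨
    2 * F (q * c)
      ∎
    where
    open ≤-Reasoning
    [1+d]² = suc d * suc d
    s+[1+d]≡1+c : s + suc d ≡ suc c
    s+[1+d]≡1+c = ≡-trans (+-suc s d) (cong suc s+d≡c)

  [1+d]*F[1+c]≤2*F[q*c] : ∀ d {c} → threshold d ≤ c → suc d * F (suc c) ≤ 2 * F (q * c)
  [1+d]*F[1+c]≤2*F[q*c] d {c} large =
    F[1+c]-estimate {s = c ∸ d} {w = w} (m∸n+n≡m d≤c) (m∸n+n≡m [1+d]²≤c) (begin
      suc c               ≡⟨ cong suc (m∸n+n≡m [1+d]²≤c) ⟨
      suc (w + [1+d]²)    ≡⟨ +-suc w [1+d]² ⟨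
      w + suc [1+d]²      ≤⟨ +-monoʳ-≤ w 1+[1+d]²≤w ⟩
      w + w               ≡⟨ cong (w +_) (+-identityʳ w) ⟨
      2 * w               ≤⟨ *-monoˡ-≤ w 1<q ⟩
      q * w               ∎)
    where
    open ≤-Reasoning
    [1+d]² = suc d * suc d
    w = c ∸ [1+d]²
    [1+d]²≤c : [1+d]² ≤ c
    [1+d]²≤c = ≤-trans (m≤m+n [1+d]² [1+d]²) (≤-trans (n≤1+n _) large)
    d≤c : d ≤ c
    d≤c = ≤-trans (≤-trans (n≤1+n d) (m≤m*n (suc d) (suc d))) [1+d]²≤c
    1+[1+d]²≤w : suc [1+d]² ≤ w
    1+[1+d]²≤w = subst (_≤ w) (m+n∸n≡m (suc [1+d]²) [1+d]²) (∸-monoˡ-≤ [1+d]² large)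

  [1+k]*F[1+c]<F[q*c] : ∀ k {c} → threshold (suc (2 * suc k)) ≤ c →
                        suc k * F (suc c) < F (q * c)
  [1+k]*F[1+c]<F[q*c] k {c} large = *-cancelˡ-< 2 (suc k * F (suc c)) (F (q * c)) (begin-strict
    2 * (suc k * F (suc c))        <⟨ *-monoʳ-< 2 (m<n+m (suc k * F (suc c)) (F>0 (suc c))) ⟩
    2 * (suc (suc k) * F (suc c))  ≡⟨ *-assoc 2 (suc (suc k)) (F (suc c)) ⟨
    2 * suc (suc k) * F (suc c)    ≡⟨ cong (_* F (suc c)) (*-suc 2 (suc k)) ⟩
    (2 + 2 * suc k) * F (suc c)    ≤⟨ [1+d]*F[1+c]≤2*F[q*c] (suc (2 * suc k)) large ⟩
    2 * F (q * c)                  ∎)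
    where open ≤-Reasoning

  F-jump : ∀ {n c} → suc n ≡ suc c * q → F n ≡ F (q * c) × ∣ F (suc n) - F n ∣ ≡ F (suc c)
  F-jump {n} {c} 1+n≡[1+c]*q = F[n]≡F[q*c] , (begin
    ∣ F (suc n) - F n ∣        ≡⟨ cong ∣_- F n ∣ (F-suc-∣ (divides (suc c) 1+n≡[1+c]*q)) ⟩
    ∣ F n + F (suc c) - F n ∣  ≡⟨ ∣-∣-comm (F n + F (suc c)) (F n) ⟩
    ∣ F n - F n + F (suc c) ∣  ≡⟨ ∣m-m+n∣≡n (F n) (F (suc c)) ⟩
    F (suc c)                  ∎)
    where
    open ≡-Reasoning
    n≡q*c+pred[q] : n ≡ q * c + pred q
    n≡q*c+pred[q] = suc-injective (≡-trans 1+n≡[1+c]*q (sym (1+[q*c+pred[q]]≡[1+c]*q c)))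
    F[n]≡F[q*c] : F n ≡ F (q * c)
    F[n]≡F[q*c] = ≡-trans (cong F n≡q*c+pred[q]) (F-block c (≤-reflexive (suc-pred q)))

  ratio→1 : ∀ k → ∃ λ N → ∀ n → n ≥ N → suc k * ∣ F (suc n) - F n ∣ < F n
  ratio→1 k = q * threshold d , bound
    where
    d = suc (2 * suc k)
    bound : ∀ n → n ≥ q * threshold d → suc k * ∣ F (suc n) - F n ∣ < F n
    bound n _ with q ∣? suc n
    bound n _ | no q∤1+n = begin-strict
      suc k * ∣ F (suc n) - F n ∣  ≡⟨ cong (λ z → suc k * ∣ z - F n ∣) (F-suc-∤ q∤1+n) ⟩
      suc k * ∣ F n - F n ∣        ≡⟨ cong (suc k *_) (∣n-n∣≡0 (F n)) ⟩
      suc k * 0                    ≡⟨ *-zeroʳ (suc k) ⟩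
      0                            <⟨ F>0 n ⟩
      F n                          ∎
      where open ≤-Reasoning
    bound n n≥q*M | yes (divides (suc c) 1+n≡[1+c]*q) with F-jump 1+n≡[1+c]*q
    ... | F[n]≡F[q*c] , ∣ΔF∣≡F[1+c] = begin-strict
      suc k * ∣ F (suc n) - F n ∣  ≡⟨ cong (suc k *_) ∣ΔF∣≡F[1+c] ⟩
      suc k * F (suc c)            <⟨ [1+k]*F[1+c]<F[q*c] k M≤c ⟩
      F (q * c)                    ≡⟨ F[n]≡F[q*c] ⟨
      F n                          ∎
      where
      open ≤-Reasoning
      M≤c : threshold d ≤ c
      M≤c = s≤s⁻¹ (*-cancelˡ-< q (threshold d) (suc c)
              (≤-trans (s≤s n≥q*M) (≤-reflexive (≡-trans 1+n≡[1+c]*q (*-comm (suc c) q)))))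

theorem4 : (q : ℕ) → 2 < q → ¬ (2 ∣ q) →
    (k : ℕ) → ∃ λ N → (n : ℕ) → n ≥ N →
      suc k * ∣ f q (suc n) - f q n ∣ < f q n
theorem4 q 2<q q-odd = ratio→1 1<q (f q) f[0]>0 (f-suc-∤ 1<q q-odd) (f-suc-∣ 1<q q-odd)
  where
  1<q : 1 < q
  1<q = <⇒≤ 2<q
  f[0]>0 : f q 0 > 0
  f[0]>0 = z<s
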